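{- Let $u_{n,k,\ell}$ be the number of cyclically ordered partitions of $\{1,\dots,n\}$ with $k$ blocks and $\ell$ right valleys in the list of openers (so $u_{n,k,\ell}=0$ when $\ell<0$). Then $$u_{n,k,\ell}=k\,u_{n-1,k,\ell}+(2\ell+1)\,u_{n-1,k-1,\ell}+(k-2\ell)\,u_{n-1,k-1,\ell-1}$$ for $n\ge 2$, $\ell\ge 0$, $2\ell+1\le k\le n$.
   Context: A cyclically ordered partition of $\{1,\dots,n\}$ is a set partition of $\{1,\dots,n\}$ whose blocks are endowed with a cyclic order; it is represented canonically as a list of blocks in which the first block contains $1$ (the other blocks following in the cyclic order) and each block is an increasing list. The opener of a block is its least element; the list of openers is the list of openers of the blocks in canonical order (e.g. $(1)(3)(2)$ has list of openers $132$). For a list of distinct integers $w_1\cdots w_m$, with the convention $w_{m+1}=\infty$, a right valley is an entry $w_i$ with $i\in\{2,\dots,m\}$ such that $w_{i-1}>w_i<w_{i+1}$. -}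

module Defs where

open import Data.Nat using (ℕ; zero; suc; _+_; _<ᵇ_; _≡ᵇ_)
open import Data.Integer using (ℤ; +_; -[1+_])
open import Data.Bool using (Bool; true; false; _∧_; if_then_else_)
open import Data.Fin using (Fin; toℕ)
open import Data.Vec using (Vec; []; _∷_; toList)
open import Data.List using (List; []; _∷_; [_]; map; concatMap; filterᵇ; length)
open import Data.Bool.ListAction using (all; any)
open import Data.List using () renaming (allFin to allFinL)

-- A cyclically ordered partition of {1,…,n} with k blocks, in canonical form
-- (blocks B₀ B₁ … B_{k-1}, B₀ ∋ 1, each block increasing), is encoded by the
-- block-index vector v : Vec (Fin k) n, where v[i-1] = j iff i ∈ B_j.
-- Canonical forms correspond exactly to the vectors that are surjective
-- (every block nonempty) and send 1 to block 0.

allVecs : (n k : ℕ) → List (Vec (Fin k) n)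
allVecs zero    k = [ [] ]
allVecs (suc n) k = concatMap (λ i → map (i ∷_) (allVecs n k)) (allFinL k)

finEq : ∀ {k} → Fin k → Fin k → Bool
finEq a b = toℕ a ≡ᵇ toℕ b

surjective : ∀ {n k} → Vec (Fin k) n → Bool
surjective {k = k} v = all (λ j → any (finEq j) (toList v)) (allFinL k)

oneInFirstBlock : ∀ {n k} → Vec (Fin k) n → Bool
oneInFirstBlock []      = true
oneInFirstBlock (x ∷ _) = toℕ x ≡ᵇ 0

isCanonical : ∀ {n k} → Vec (Fin k) n → Bool
isCanonical v = surjective v ∧ oneInFirstBlock v

firstPos : ∀ {k} → Fin k → ℕ → List (Fin k) → ℕ
firstPos j pos []       = 0
firstPos j pos (x ∷ xs) = if finEq j x then pos else firstPos j (suc pos) xs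

opener : ∀ {n k} → Vec (Fin k) n → Fin k → ℕ
opener v j = firstPos j 1 (toList v)

openers : ∀ {n k} → Vec (Fin k) n → List ℕ
openers {k = k} v = map (opener v) (allFinL k)

-- number of right valleys of w₁⋯w_m (convention w_{m+1} = ∞):
-- positions i ∈ {2,…,m} with w_{i-1} > w_i < w_{i+1}
private
  rvGo : ℕ → List ℕ → ℕ
  rvGo p []           = 0
  rvGo p (x ∷ [])     = if x <ᵇ p then 1 else 0
  rvGo p (x ∷ y ∷ r)  = (if (x <ᵇ p) ∧ (x <ᵇ y) then 1 else 0) + rvGo x (y ∷ r)

rightValleys : List ℕ → ℕ
rightValleys []       = 0
rightValleys (w ∷ ws) = rvGo w ws

u : ℕ → ℕ → ℤ → ℕ
u n k -[1+ _ ] = 0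
u n k (+ ℓ)    =
  length (filterᵇ (λ v → isCanonical v ∧ (rightValleys (openers v) ≡ᵇ ℓ)) (allVecs n k))

-- Classify the partitions of {1,…,n} by the block of n, the last letter of the block-index word.
-- If n joins one of the k blocks of a partition of {1,…,n−1}, the openers do not change: k·u(n−1,k,ℓ).
-- Otherwise {n} is a new singleton block at one of the k−1 cyclic positions after the block of 1, which
-- inserts the maximum n into one of the k−1 gaps after the leading 1 of the list of openers. Such an
-- insertion creates at most one right valley, and if the list has r right valleys then exactly 2r+1 of
-- the gaps create none; taking r = ℓ and r = ℓ−1 gives the last two terms.

module Submission where

open import Defs
open import Data.Nat using (ℕ; zero; suc; _+_; _*_; _∸_; _≤_; _<_; _<ᵇ_; _≡ᵇ_; z≤n; s≤s; z<s)
import Data.Nat as ℕ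
open import Data.Nat.Properties
  using (+-*-semiring; +-identityʳ; +-suc; +-comm; +-assoc; *-zeroʳ; *-identityʳ; *-identityˡ;
         m+n∸m≡n; m+n≤o⇒n≤o; <⇒≤; ≤-refl; ≤-trans; ≤-reflexive; n≤1+n; m<m+n; 1+n≰n)
open import Data.Nat.Tactic.RingSolver using (solve-∀)
open import Data.Integer using (ℤ; +_; -[1+_]) renaming (_-_ to _-ℤ_)
open import Data.Bool using (Bool; true; false; _∧_; _∨_; not; if_then_else_)
import Data.Bool.Properties as Bool
open import Data.Bool.Properties using (∧-identityʳ; ∧-zeroʳ; ∨-identityʳ)
open import Data.Bool.ListAction using (all; any; and; or)
open import Data.Fin using (Fin; zero; suc; toℕ; punchIn)
open import Data.Fin.Properties using (toℕ-injective; punchIn-injective; punchInᵢ≢i)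
open import Data.Vec using (Vec; []; _∷_; toList; _∷ʳ_)
import Data.Vec as Vec
import Data.Vec.Properties as Vec
open import Data.List using (List; []; _∷_; [_]; _++_; map; concatMap; filterᵇ; length; tabulate; allFin)
import Data.List.Properties as List
open import Data.List.Relation.Unary.All using (All; []; _∷_)
import Data.List.Relation.Unary.All.Properties as All
open import Data.List.Relation.Unary.AllPairs using (AllPairs)
import Data.List.Relation.Unary.AllPairs.Properties as AllPairs
open import Data.List.Relation.Unary.Linked using (Linked; _∷_)
import Data.List.Relation.Unary.Linked as Linked
import Data.List.Relation.Unary.Linked.Properties as Linked
open import Data.Empty using (⊥-elim)
open import Function using (_∘_; mk⇔)
open import Function.Definitions using (Injective)
open import Relation.Nullary using (Dec; Reflects; ofʸ; ofⁿ; proof; map′)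
open import Relation.Nullary.Decidable using (dec-true; dec-false; does-⇔)
open import Relation.Binary.PropositionalEquality hiding ([_])
open import Algebra.Properties.Semiring.Sum +-*-semiring
  using (sum-syntax; sum-cong-≗; sum-remove; sum-replicate-zero; ∑-distrib-+; ∑-comm;
         *-distribˡ-sum; *-distribʳ-sum)
import Algebra.Properties.CommutativeMonoid.Sum Bool.∧-commutativeMonoid as ⋀

-- Finite sums

χ : Bool → ℕ
χ b = if b then 1 else 0

χ-not : ∀ b → χ (not b) + χ b ≡ 1
χ-not true  = refl
χ-not false = refl

χ-∧ : ∀ a b → χ (a ∧ b) ≡ χ a * χ b
χ-∧ true  b = sym (+-identityʳ (χ b))
χ-∧ false b = refl

χ-not-∨ : ∀ a b c → χ (not (a ∨ b)) * c ≡ χ (not a) * (χ (not b) * c)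
χ-not-∨ true  b c = refl
χ-not-∨ false b c = sym (+-identityʳ _)

∑-cong : ∀ k {f g : Fin k → ℕ} → (∀ i → f i ≡ g i) → ∑[ i < k ] f i ≡ ∑[ i < k ] g i
∑-cong k = sum-cong-≗ {k}

∑-const : ∀ k c → ∑[ i < k ] c ≡ k * c
∑-const zero    c = refl
∑-const (suc k) c = cong (_+_ c) (∑-const k c)

∑-χ-not : ∀ k (b : Fin k → Bool) → ∑[ q < k ] χ (not (b q)) + ∑[ q < k ] χ (b q) ≡ k
∑-χ-not k b = begin
  ∑[ q < k ] χ (not (b q)) + ∑[ q < k ] χ (b q) ≡⟨ ∑-distrib-+ {k} (χ ∘ not ∘ b) (χ ∘ b) ⟨
  ∑[ q < k ] (χ (not (b q)) + χ (b q))          ≡⟨ ∑-cong k (χ-not ∘ b) ⟩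
  ∑[ q < k ] 1                                   ≡⟨ ∑-const k 1 ⟩
  k * 1                                          ≡⟨ *-identityʳ k ⟩
  k                                              ∎
  where open ≡-Reasoning

∑-χ-split : ∀ k (b : Fin k → Bool) A B →
  ∑[ q < k ] (χ (not (b q)) * A + χ (b q) * B)
  ≡ ∑[ q < k ] χ (not (b q)) * A + (k ∸ ∑[ q < k ] χ (not (b q))) * B
∑-χ-split k b A B = begin
  ∑[ q < k ] (χ (not (b q)) * A + χ (b q) * B)
    ≡⟨ ∑-distrib-+ {k} (λ q → χ (not (b q)) * A) (λ q → χ (b q) * B) ⟩
  ∑[ q < k ] (χ (not (b q)) * A) + ∑[ q < k ] (χ (b q) * B)
    ≡⟨ cong₂ _+_ (*-distribʳ-sum A (χ ∘ not ∘ b)) (*-distribʳ-sum B (χ ∘ b)) ⟨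
  S * A + ∑[ q < k ] χ (b q) * B
    ≡⟨ cong (λ t → S * A + t * B) (trans (sym (m+n∸m≡n S _)) (cong (_∸ S) (∑-χ-not k b))) ⟩
  S * A + (k ∸ S) * B
    ∎
  where
  open ≡-Reasoning
  S = ∑[ q < k ] χ (not (b q))

sumVec : ∀ {k} n → (Vec (Fin k) n → ℕ) → ℕ
sumVec     zero    f = f []
sumVec {k} (suc n) f = ∑[ i < k ] sumVec n (f ∘ (i ∷_))

sumVec-cong : ∀ {k} n {f g : Vec (Fin k) n → ℕ} → (∀ v → f v ≡ g v) → sumVec n f ≡ sumVec n g
sumVec-cong zero    f≗g = f≗g []
sumVec-cong (suc n) f≗g = sum-cong-≗ λ i → sumVec-cong n (f≗g ∘ (i ∷_))

sumVec-zero : ∀ {k} n → sumVec {k} n (λ _ → 0) ≡ 0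
sumVec-zero     zero    = refl
sumVec-zero {k} (suc n) = trans (∑-cong k λ _ → sumVec-zero n) (sum-replicate-zero k)

sumVec-distrib-+ : ∀ {k} n (f g : Vec (Fin k) n → ℕ) →
  sumVec n (λ v → f v + g v) ≡ sumVec n f + sumVec n g
sumVec-distrib-+ zero    f g = refl
sumVec-distrib-+ {k} (suc n) f g =
  trans (∑-cong k λ i → sumVec-distrib-+ n (f ∘ (i ∷_)) (g ∘ (i ∷_)))
        (∑-distrib-+ {k} (λ i → sumVec n (f ∘ (i ∷_))) (λ i → sumVec n (g ∘ (i ∷_))))

*-distribˡ-sumVec : ∀ {k} n c (f : Vec (Fin k) n → ℕ) → c * sumVec n f ≡ sumVec n (λ v → c * f v)
*-distribˡ-sumVec zero    c f = refl
*-distribˡ-sumVec {k} (suc n) c f =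
  trans (*-distribˡ-sum {k} c λ i → sumVec n (f ∘ (i ∷_)))
        (∑-cong k λ i → *-distribˡ-sumVec n c (f ∘ (i ∷_)))

sumVec-∑-comm : ∀ {k} n m (g : Fin m → Vec (Fin k) n → ℕ) →
  sumVec n (λ v → ∑[ i < m ] g i v) ≡ ∑[ i < m ] sumVec n (g i)
sumVec-∑-comm zero    m g = refl
sumVec-∑-comm {k} (suc n) m g =
  trans (∑-cong k λ j → sumVec-∑-comm n m (λ i → g i ∘ (j ∷_)))
        (∑-comm {k} {m} λ j i → sumVec n (g i ∘ (j ∷_)))

sumVec-∷ʳ : ∀ {k} n (f : Vec (Fin k) (suc n) → ℕ) →
  sumVec (suc n) f ≡ sumVec n (λ v → ∑[ i < k ] f (v ∷ʳ i))
sumVec-∷ʳ zero    f = refl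
sumVec-∷ʳ {k} (suc n) f = ∑-cong k λ j → sumVec-∷ʳ n (f ∘ (j ∷_))

length-filterᵇ-++ : ∀ {A : Set} (p : A → Bool) xs ys →
  length (filterᵇ p (xs ++ ys)) ≡ length (filterᵇ p xs) + length (filterᵇ p ys)
length-filterᵇ-++ p xs ys =
  trans (cong length (List.filter-++ _ xs ys)) (List.length-++ (filterᵇ p xs))

length-filterᵇ-map : ∀ {A B : Set} (p : B → Bool) (f : A → B) xs →
  length (filterᵇ p (map f xs)) ≡ length (filterᵇ (p ∘ f) xs)
length-filterᵇ-map p f []       = refl
length-filterᵇ-map p f (x ∷ xs) with p (f x)
... | true  = cong suc (length-filterᵇ-map p f xs)
... | false = length-filterᵇ-map p f xs

length-filterᵇ-concatMap : ∀ {A B : Set} {k} (p : B → Bool) (f : A → List B) (g : Fin k → A) →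
  length (filterᵇ p (concatMap f (tabulate g))) ≡ ∑[ i < k ] length (filterᵇ p (f (g i)))
length-filterᵇ-concatMap {k = zero}  p f g = refl
length-filterᵇ-concatMap {k = suc k} p f g =
  trans (length-filterᵇ-++ p (f (g zero)) _) (cong (_+_ _) (length-filterᵇ-concatMap p f (g ∘ suc)))

length-filterᵇ-allVecs : ∀ n k (p : Vec (Fin k) n → Bool) →
  length (filterᵇ p (allVecs n k)) ≡ sumVec n (χ ∘ p)
length-filterᵇ-allVecs zero    k p with p []
... | true  = refl
... | false = refl
length-filterᵇ-allVecs (suc n) k p =
  trans (length-filterᵇ-concatMap {k = k} p _ (λ i → i)) (∑-cong k λ i →
    trans (length-filterᵇ-map p (i ∷_) (allVecs n k)) (length-filterᵇ-allVecs n k (p ∘ (i ∷_))))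

-- Right valleys after inserting a maximum

insertAt : ℕ → ℕ → List ℕ → List ℕ
insertAt zero    y xs       = y ∷ xs
insertAt (suc q) y []       = [ y ]
insertAt (suc q) y (x ∷ xs) = x ∷ insertAt q y xs

_<head_ : ℕ → List ℕ → Bool
x <head []      = true
x <head (y ∷ _) = x <ᵇ y

_>head_ : ℕ → List ℕ → Bool
x >head []      = false
x >head (y ∷ _) = y <ᵇ x

-- Whether inserting a value above all entries, right after p and the first q entries of xs,
-- creates a right valley.
createsValley : ℕ → List ℕ → ℕ → Bool
createsValley p []       q             = false
createsValley p (x ∷ xs) zero          = (p <ᵇ x) ∧ (x <head xs)
createsValley p (x ∷ xs) (suc zero)    = ((x <ᵇ p) ∧ (x >head xs)) ∨ createsValley x xs zero
createsValley p (x ∷ xs) (suc (suc q)) = createsValley x xs (suc q)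

data Ordered (x y : ℕ) : Set where
  less    : (x <ᵇ y) ≡ true  → (y <ᵇ x) ≡ false → Ordered x y
  greater : (x <ᵇ y) ≡ false → (y <ᵇ x) ≡ true  → Ordered x y

ordered : ∀ x y → y ≢ x → Ordered x y
ordered zero    zero    y≢x = ⊥-elim (y≢x refl)
ordered zero    (suc y) y≢x = less refl refl
ordered (suc x) zero    y≢x = greater refl refl
ordered (suc x) (suc y) y≢x with ordered x y (y≢x ∘ cong suc)
... | less    x<y y≮x = less x<y y≮x
... | greater x≮y y<x = greater x≮y y<x

<⇒<ᵇ≡true : ∀ {x y} → x < y → (x <ᵇ y) ≡ true
<⇒<ᵇ≡true {zero}  (s≤s _)   = refl
<⇒<ᵇ≡true {suc x} (s≤s x<y) = <⇒<ᵇ≡true x<y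

≥⇒<ᵇ≡false : ∀ {x y} → y ≤ x → (x <ᵇ y) ≡ false
≥⇒<ᵇ≡false z≤n       = refl
≥⇒<ᵇ≡false (s≤s y≤x) = ≥⇒<ᵇ≡false y≤x

all≥⇒>head≡false : ∀ {p xs} → All (p ≤_) xs → p >head xs ≡ false
all≥⇒>head≡false []        = refl
all≥⇒>head≡false (p≤x ∷ _) = ≥⇒<ᵇ≡false p≤x

rightValleys-∷ : ∀ p x xs →
  rightValleys (p ∷ x ∷ xs) ≡ χ ((x <ᵇ p) ∧ (x <head xs)) + rightValleys (x ∷ xs)
rightValleys-∷ p x []      = trans (cong χ (sym (∧-identityʳ (x <ᵇ p)))) (sym (+-identityʳ _))
rightValleys-∷ p x (y ∷ r) = refl

rightValleys-insertAt : ∀ {N} p xs q → All (_< N) (p ∷ xs) → Linked _≢_ (p ∷ xs) →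
  rightValleys (p ∷ insertAt q N xs) ≡ rightValleys (p ∷ xs) + χ (createsValley p xs q)
rightValleys-insertAt p [] zero (p<N ∷ []) _ rewrite ≥⇒<ᵇ≡false (<⇒≤ p<N) = refl
rightValleys-insertAt p [] (suc q) (p<N ∷ []) _ rewrite ≥⇒<ᵇ≡false (<⇒≤ p<N) = refl
rightValleys-insertAt {N} p (x ∷ xs) zero (p<N ∷ x<N ∷ _) (p≢x ∷ _)
  rewrite ≥⇒<ᵇ≡false (<⇒≤ p<N) | rightValleys-∷ N x xs | <⇒<ᵇ≡true x<N | rightValleys-∷ p x xs
  with ordered x p p≢x
... | less    x<p p≮x rewrite x<p | p≮x = sym (+-identityʳ _)
... | greater x≮p p<x rewrite x≮p | p<x = +-comm (χ (x <head xs)) _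
rightValleys-insertAt p (x ∷ []) (suc zero) (_ ∷ x<N ∷ _) _
  rewrite <⇒<ᵇ≡true x<N | ≥⇒<ᵇ≡false (<⇒≤ x<N) with x <ᵇ p
... | true  = refl
... | false = refl
rightValleys-insertAt p (x ∷ y ∷ r) (suc zero) (_ ∷ x<N ∷ y<N ∷ r<N) (_ ∷ x≢y ∷ y-r)
  rewrite <⇒<ᵇ≡true x<N | rightValleys-insertAt x (y ∷ r) zero (x<N ∷ y<N ∷ r<N) (x≢y ∷ y-r)
  with x <ᵇ p
... | false = refl
... | true with ordered y x x≢y
...   | less    y<x x≮y rewrite y<x | x≮y = trans (cong suc (+-identityʳ _)) (+-comm 1 _)
...   | greater y≮x x<y rewrite y≮x | x<y = refl
rightValleys-insertAt p (x ∷ []) (suc (suc q)) (_ ∷ x<N ∷ _) _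
  rewrite <⇒<ᵇ≡true x<N | ≥⇒<ᵇ≡false (<⇒≤ x<N) | ∧-identityʳ (x <ᵇ p) = refl
rightValleys-insertAt p (x ∷ y ∷ r) (suc (suc q)) (_ ∷ xyr<N) (_ ∷ xyr-linked) =
  trans (cong (_+_ valley-x) (rightValleys-insertAt x (y ∷ r) (suc q) xyr<N xyr-linked))
        (sym (+-assoc valley-x _ _))
  where
  valley-x = χ ((x <ᵇ p) ∧ (x <ᵇ y))

neutralSlots : ℕ → List ℕ → ℕ
neutralSlots p xs = ∑[ q < suc (length xs) ] χ (not (createsValley p xs (toℕ q)))

neutralSlots-rightValleys : ∀ p xs → Linked _≢_ (p ∷ xs) →
  neutralSlots p xs + χ (p >head xs) ≡ 2 * rightValleys (p ∷ xs) + 1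
neutralSlots-rightValleys p []       _         = refl
neutralSlots-rightValleys p (x ∷ []) (p≢x ∷ _) with ordered x p p≢x
... | less    x<p p≮x rewrite x<p | p≮x = refl
... | greater x≮p p<x rewrite x≮p | p<x = refl
neutralSlots-rightValleys p (x ∷ y ∷ r) (p≢x ∷ x-yr)
  with neutralSlots-rightValleys x (y ∷ r) x-yr | ordered x p p≢x | ordered y x (Linked.head x-yr)
... | ih | less x<p p≮x | less y<x x≮y rewrite x<p | p≮x | y<x | x≮y = ih
... | ih | less x<p p≮x | greater y≮x x<y rewrite x<p | p≮x | y≮x | x<y =
  trans (cong (λ t → suc (t + 1)) (trans (sym (+-identityʳ _)) ih)) (two-more (rightValleys (x ∷ y ∷ r)))
  where
  two-more : ∀ R → suc (2 * R + 1 + 1) ≡ 2 * (1 + R) + 1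
  two-more = solve-∀
... | ih | greater x≮p p<x | less y<x x≮y rewrite x≮p | p<x | y<x | x≮y =
  trans (+-identityʳ _) (trans (+-comm 1 _) ih)
... | ih | greater x≮p p<x | greater y≮x x<y rewrite x≮p | p<x | y≮x | x<y = ih

*-zero-both : ∀ a b → a * 0 ≡ b * 0
*-zero-both a b = trans (*-zeroʳ a) (sym (*-zeroʳ b))

-- does (m ≟ n) reduces to m ≡ᵇ n.
≡ᵇ-reflects : ∀ m n → Reflects (m ≡ n) (m ≡ᵇ n)
≡ᵇ-reflects m n = proof (m ℕ.≟ n)

valleyCoefficients : ∀ r ℓ K →
  (2 * r + 1) * χ (r ≡ᵇ ℓ) + (K ∸ (2 * r + 1)) * χ (suc r ≡ᵇ ℓ)
  ≡ (2 * ℓ + 1) * χ (r ≡ᵇ ℓ) + (suc K ∸ 2 * ℓ) * χ (suc r ≡ᵇ ℓ)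
valleyCoefficients r ℓ K with r ≡ᵇ ℓ | ≡ᵇ-reflects r ℓ | suc r ≡ᵇ ℓ | ≡ᵇ-reflects (suc r) ℓ
... | true  | ofʸ refl | _     | ofʸ ()
... | true  | ofʸ refl | _     | ofⁿ _    =
  cong (_+_ ((2 * r + 1) * 1)) (*-zero-both (K ∸ (2 * r + 1)) (suc K ∸ 2 * r))
... | false | _        | true  | ofʸ refl =
  cong₂ _+_ (*-zero-both (2 * r + 1) (2 * suc r + 1)) (cong (λ m → (suc K ∸ m) * 1) (sym (double-suc r)))
  where
  double-suc : ∀ r → 2 * suc r ≡ suc (2 * r + 1)
  double-suc = solve-∀
... | false | _        | false | _        =
  cong₂ _+_ (*-zero-both (2 * r + 1) (2 * ℓ + 1)) (*-zero-both (K ∸ (2 * r + 1)) (suc K ∸ 2 * ℓ))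

χ-+-≡ᵇ : ∀ r b ℓ → χ (r + χ b ≡ᵇ ℓ) ≡ χ (not b) * χ (r ≡ᵇ ℓ) + χ b * χ (suc r ≡ᵇ ℓ)
χ-+-≡ᵇ r false ℓ rewrite +-identityʳ r = sym (trans (+-identityʳ _) (*-identityˡ _))
χ-+-≡ᵇ r true  ℓ rewrite +-comm r 1   = sym (+-identityʳ _)

insertMax-valleys : ∀ {N L} p xs ℓ → length xs ≡ L →
  All (_< N) (p ∷ xs) → Linked _≢_ (p ∷ xs) → p >head xs ≡ false →
  let r = rightValleys (p ∷ xs) in
  ∑[ q < suc L ] χ (rightValleys (p ∷ insertAt (toℕ q) N xs) ≡ᵇ ℓ)
  ≡ (2 * ℓ + 1) * χ (r ≡ᵇ ℓ) + (suc (suc L) ∸ 2 * ℓ) * χ (suc r ≡ᵇ ℓ)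
insertMax-valleys {N} p xs ℓ refl below linked p≯head = begin
  ∑[ q < K ] χ (rightValleys (p ∷ insertAt (toℕ q) N xs) ≡ᵇ ℓ)
    ≡⟨ ∑-cong K (λ q → trans (cong (λ m → χ (m ≡ᵇ ℓ)) (rightValleys-insertAt p xs (toℕ q) below linked))
                             (χ-+-≡ᵇ r (creates q) ℓ)) ⟩
  ∑[ q < K ] (χ (not (creates q)) * χ (r ≡ᵇ ℓ) + χ (creates q) * χ (suc r ≡ᵇ ℓ))
    ≡⟨ ∑-χ-split K creates _ _ ⟩
  neutralSlots p xs * χ (r ≡ᵇ ℓ) + (K ∸ neutralSlots p xs) * χ (suc r ≡ᵇ ℓ)
    ≡⟨ cong (λ s → s * χ (r ≡ᵇ ℓ) + (K ∸ s) * χ (suc r ≡ᵇ ℓ)) neutralSlots≡ ⟩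
  (2 * r + 1) * χ (r ≡ᵇ ℓ) + (K ∸ (2 * r + 1)) * χ (suc r ≡ᵇ ℓ)
    ≡⟨ valleyCoefficients r ℓ K ⟩
  (2 * ℓ + 1) * χ (r ≡ᵇ ℓ) + (suc K ∸ 2 * ℓ) * χ (suc r ≡ᵇ ℓ)
    ∎
  where
  open ≡-Reasoning
  K = suc (length xs)
  r = rightValleys (p ∷ xs)
  creates : Fin K → Bool
  creates q = createsValley p xs (toℕ q)
  neutralSlots≡ : neutralSlots p xs ≡ 2 * r + 1
  neutralSlots≡ = trans (sym (+-identityʳ _))
    (trans (cong (λ b → neutralSlots p xs + χ b) (sym p≯head)) (neutralSlots-rightValleys p xs linked))

-- Occurrences and openers

-- does (finEq? a b) reduces to finEq a b.
finEq? : ∀ {k} (a b : Fin k) → Dec (a ≡ b)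
finEq? a b = map′ toℕ-injective (cong toℕ) (toℕ a ℕ.≟ toℕ b)

finEq-reflects : ∀ {k} (a b : Fin k) → Reflects (a ≡ b) (finEq a b)
finEq-reflects a b = proof (finEq? a b)

finEq-refl : ∀ {k} (a : Fin k) → finEq a a ≡ true
finEq-refl a = dec-true (finEq? a a) refl

finEq-injective : ∀ {k k′} {f : Fin k → Fin k′} → Injective _≡_ _≡_ f →
  ∀ a b → finEq (f a) (f b) ≡ finEq a b
finEq-injective {f = f} f-inj a b = does-⇔ (mk⇔ f-inj (cong f)) (finEq? (f a) (f b)) (finEq? a b)

any-++ : ∀ {A : Set} (p : A → Bool) xs ys → any p (xs ++ ys) ≡ any p xs ∨ any p ys
any-++ p []       ys = refl
any-++ p (x ∷ xs) ys = trans (cong (p x ∨_) (any-++ p xs ys)) (sym (Bool.∨-assoc (p x) _ _))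

any-map-injective : ∀ {k k′} {f : Fin k → Fin k′} → Injective _≡_ _≡_ f →
  ∀ j xs → any (finEq (f j)) (map f xs) ≡ any (finEq j) xs
any-map-injective f-inj j xs =
  cong or (trans (sym (List.map-∘ xs)) (List.map-cong (finEq-injective f-inj j) xs))

any-punchIn-self : ∀ {k} (i : Fin (suc k)) xs → any (finEq i) (map (punchIn i) xs) ≡ false
any-punchIn-self i []       = refl
any-punchIn-self i (x ∷ xs)
  rewrite dec-false (finEq? i (punchIn i x)) (punchInᵢ≢i i x ∘ sym) = any-punchIn-self i xs

firstPos-++ : ∀ {k} (j : Fin k) p xs ys → any (finEq j) xs ≡ true →
  firstPos j p (xs ++ ys) ≡ firstPos j p xs
firstPos-++ j p (x ∷ xs) ys j∈xs with finEq j x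
... | true  = refl
... | false = firstPos-++ j (suc p) xs ys j∈xs

firstPos-∷ʳ-absent : ∀ {k} (j : Fin k) p xs → any (finEq j) xs ≡ false →
  firstPos j p (xs ++ [ j ]) ≡ p + length xs
firstPos-∷ʳ-absent j p []       _ rewrite finEq-refl j = sym (+-identityʳ p)
firstPos-∷ʳ-absent j p (x ∷ xs) j∉xs with finEq j x
... | false = trans (firstPos-∷ʳ-absent j (suc p) xs j∉xs) (sym (+-suc p (length xs)))

firstPos-map-injective : ∀ {k k′} {f : Fin k → Fin k′} → Injective _≡_ _≡_ f →
  ∀ j p xs → firstPos (f j) p (map f xs) ≡ firstPos j p xs
firstPos-map-injective f-inj j p []       = refl
firstPos-map-injective f-inj j p (x ∷ xs) rewrite finEq-injective f-inj j x with finEq j x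
... | true  = refl
... | false = firstPos-map-injective f-inj j (suc p) xs

firstPos-≥ : ∀ {k} (j : Fin k) p xs → any (finEq j) xs ≡ true → p ≤ firstPos j p xs
firstPos-≥ j p (x ∷ xs) j∈xs with finEq j x
... | true  = ≤-refl
... | false = ≤-trans (n≤1+n p) (firstPos-≥ j (suc p) xs j∈xs)

firstPos-< : ∀ {k} (j : Fin k) p xs → any (finEq j) xs ≡ true → firstPos j p xs < p + length xs
firstPos-< j p (x ∷ xs) j∈xs with finEq j x
... | true  = m<m+n p z<s
... | false = ≤-trans (firstPos-< j (suc p) xs j∈xs) (≤-reflexive (sym (+-suc p (length xs))))

firstPos-injective : ∀ {k} (j j′ : Fin k) p xs →
  any (finEq j) xs ≡ true → any (finEq j′) xs ≡ true → firstPos j p xs ≡ firstPos j′ p xs → j ≡ j′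
firstPos-injective j j′ p (x ∷ xs) j∈xs j′∈xs eq
  with finEq j x | finEq-reflects j x | finEq j′ x | finEq-reflects j′ x
... | true  | ofʸ refl | true  | ofʸ refl = refl
... | true  | _        | false | _        =
  ⊥-elim (1+n≰n (≤-trans (firstPos-≥ j′ (suc p) xs j′∈xs) (≤-reflexive (sym eq))))
... | false | _        | true  | _        =
  ⊥-elim (1+n≰n (≤-trans (firstPos-≥ j (suc p) xs j∈xs) (≤-reflexive eq)))
... | false | _        | false | _        = firstPos-injective j j′ (suc p) xs j∈xs j′∈xs eq

occursIn : ∀ {n k} → Fin k → Vec (Fin k) n → Bool
occursIn j v = any (finEq j) (toList v)

and-tabulate : ∀ {k} (f : Fin k → Bool) → and (tabulate f) ≡ ⋀.sum f
and-tabulate {zero}  f = refl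
and-tabulate {suc k} f = cong (f zero ∧_) (and-tabulate (f ∘ suc))

all-allFin-punchIn : ∀ {k} (p : Fin (suc k) → Bool) i →
  all p (allFin (suc k)) ≡ p i ∧ all (p ∘ punchIn i) (allFin k)
all-allFin-punchIn {k} p i = begin
  all p (allFin (suc k))
    ≡⟨ cong and (List.map-tabulate (λ j → j) p) ⟩
  and (tabulate p)
    ≡⟨ and-tabulate p ⟩
  ⋀.sum p
    ≡⟨ ⋀.sum-remove {i = i} p ⟩
  p i ∧ ⋀.sum (p ∘ punchIn i)
    ≡⟨ cong (p i ∧_) (and-tabulate (p ∘ punchIn i)) ⟨
  p i ∧ and (tabulate (p ∘ punchIn i))
    ≡⟨ cong (λ b → p i ∧ and b) (List.map-tabulate (λ j → j) (p ∘ punchIn i)) ⟨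
  p i ∧ all (p ∘ punchIn i) (allFin k)
    ∎
  where open ≡-Reasoning

∧≡true⇒ˡ : ∀ {a b} → a ∧ b ≡ true → a ≡ true
∧≡true⇒ˡ {true} _ = refl

surjective⇒occursIn : ∀ {n k} (v : Vec (Fin k) n) → surjective v ≡ true → ∀ j → occursIn j v ≡ true
surjective⇒occursIn {k = suc k} v surj j =
  ∧≡true⇒ˡ (trans (sym (all-allFin-punchIn (λ j → occursIn j v) j)) surj)

opener-≥1 : ∀ {n k} (v : Vec (Fin k) n) j → occursIn j v ≡ true → 1 ≤ opener v j
opener-≥1 v j j∈v = firstPos-≥ j 1 (toList v) j∈v

opener-< : ∀ {n k} (v : Vec (Fin k) n) j → occursIn j v ≡ true → opener v j < suc n
opener-< v j j∈v =
  ≤-trans (firstPos-< j 1 (toList v) j∈v) (≤-reflexive (cong suc (Vec.length-toList v)))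

opener-injective : ∀ {n k} (v : Vec (Fin k) n) → surjective v ≡ true →
  ∀ {i j} → opener v i ≡ opener v j → i ≡ j
opener-injective v surj {i} {j} =
  firstPos-injective i j 1 (toList v) (surjective⇒occursIn v surj i) (surjective⇒occursIn v surj j)

openers-tabulate : ∀ {n k} (v : Vec (Fin k) n) → openers v ≡ tabulate (opener v)
openers-tabulate v = List.map-tabulate (λ j → j) (opener v)

openers-distinct : ∀ {n k} (v : Vec (Fin k) n) → surjective v ≡ true → AllPairs _≢_ (openers v)
openers-distinct v surj = AllPairs.map⁺ (AllPairs.tabulate⁺ λ i≢j → i≢j ∘ opener-injective v surj)

openers-< : ∀ {n k} (v : Vec (Fin k) n) → surjective v ≡ true → All (_< suc n) (openers v)
openers-< v surj = All.map⁺ (All.tabulate⁺ λ j → opener-< v j (surjective⇒occursIn v surj j))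

openers-≥1 : ∀ {n k} (v : Vec (Fin k) n) → surjective v ≡ true → All (1 ≤_) (openers v)
openers-≥1 v surj = All.map⁺ (All.tabulate⁺ λ j → opener-≥1 v j (surjective⇒occursIn v surj j))

-- Adding the element n

occursIn-∷ʳ : ∀ {n k} (j i : Fin k) (v : Vec (Fin k) n) → occursIn j (v ∷ʳ i) ≡ occursIn j v ∨ finEq j i
occursIn-∷ʳ j i v = begin
  any (finEq j) (toList (v ∷ʳ i))               ≡⟨ cong (any (finEq j)) (Vec.toList-∷ʳ i v) ⟩
  any (finEq j) (toList v ++ [ i ])             ≡⟨ any-++ (finEq j) (toList v) [ i ] ⟩
  occursIn j v ∨ (finEq j i ∨ false)            ≡⟨ cong (occursIn j v ∨_) (∨-identityʳ (finEq j i)) ⟩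
  occursIn j v ∨ finEq j i                      ∎
  where open ≡-Reasoning

occursIn-∷ʳ-occurring : ∀ {n k} (j i : Fin k) (v : Vec (Fin k) n) → occursIn i v ≡ true →
  occursIn j (v ∷ʳ i) ≡ occursIn j v
occursIn-∷ʳ-occurring j i v i∈v rewrite occursIn-∷ʳ j i v with finEq j i | finEq-reflects j i
... | true  | ofʸ refl rewrite i∈v = refl
... | false | _                   = ∨-identityʳ (occursIn j v)

surjective-∷ʳ : ∀ {n k} (v : Vec (Fin k) n) i → occursIn i v ≡ true → surjective (v ∷ʳ i) ≡ surjective v
surjective-∷ʳ v i i∈v = cong and (List.map-cong (λ j → occursIn-∷ʳ-occurring j i v i∈v) (allFin _))

opener-∷ʳ : ∀ {n k} (v : Vec (Fin k) n) i j → occursIn j v ≡ true → opener (v ∷ʳ i) j ≡ opener v j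
opener-∷ʳ v i j j∈v =
  trans (cong (firstPos j 1) (Vec.toList-∷ʳ i v)) (firstPos-++ j 1 (toList v) [ i ] j∈v)

openers-∷ʳ : ∀ {n k} (v : Vec (Fin k) n) i → surjective v ≡ true → openers (v ∷ʳ i) ≡ openers v
openers-∷ʳ v i surj = List.map-cong (λ j → opener-∷ʳ v i j (surjective⇒occursIn v surj j)) (allFin _)

-- The partition w of {1,…,m} with the block {m+1} added at cyclic position i.
insertBlock : ∀ {m k} → Fin (suc k) → Vec (Fin k) m → Vec (Fin (suc k)) (suc m)
insertBlock i w = Vec.map (punchIn i) w ∷ʳ i

toList-insertBlock : ∀ {m k} (i : Fin (suc k)) (w : Vec (Fin k) m) →
  toList (insertBlock i w) ≡ map (punchIn i) (toList w) ++ [ i ]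
toList-insertBlock i w =
  trans (Vec.toList-∷ʳ i (Vec.map (punchIn i) w)) (cong (_++ [ i ]) (Vec.toList-map (punchIn i) w))

occursIn-insertBlock-new : ∀ {m k} (i : Fin (suc k)) (w : Vec (Fin k) m) →
  occursIn i (insertBlock i w) ≡ true
occursIn-insertBlock-new i w rewrite toList-insertBlock i w
  | any-++ (finEq i) (map (punchIn i) (toList w)) [ i ]
  | any-punchIn-self i (toList w) | finEq-refl i = refl

occursIn-insertBlock-punchIn : ∀ {m k} (i : Fin (suc k)) j (w : Vec (Fin k) m) →
  occursIn (punchIn i j) (insertBlock i w) ≡ occursIn j w
occursIn-insertBlock-punchIn i j w rewrite toList-insertBlock i w
  | any-++ (finEq (punchIn i j)) (map (punchIn i) (toList w)) [ i ]
  | any-map-injective (punchIn-injective i _ _) j (toList w)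
  | dec-false (finEq? (punchIn i j) i) (punchInᵢ≢i i j) = ∨-identityʳ (occursIn j w)

surjective-insertBlock : ∀ {m k} (i : Fin (suc k)) (w : Vec (Fin k) m) →
  surjective (insertBlock i w) ≡ surjective w
surjective-insertBlock i w rewrite all-allFin-punchIn (λ j → occursIn j (insertBlock i w)) i
  | occursIn-insertBlock-new i w =
  cong and (List.map-cong (λ j → occursIn-insertBlock-punchIn i j w) (allFin _))

opener-insertBlock-new : ∀ {m k} (i : Fin (suc k)) (w : Vec (Fin k) m) →
  opener (insertBlock i w) i ≡ suc m
opener-insertBlock-new i w rewrite toList-insertBlock i w =
  trans (firstPos-∷ʳ-absent i 1 (map (punchIn i) (toList w)) (any-punchIn-self i (toList w)))
        (cong suc (trans (List.length-map (punchIn i) (toList w)) (Vec.length-toList w)))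

opener-insertBlock-punchIn : ∀ {m k} (i : Fin (suc k)) j (w : Vec (Fin k) m) → occursIn j w ≡ true →
  opener (insertBlock i w) (punchIn i j) ≡ opener w j
opener-insertBlock-punchIn i j w j∈w rewrite toList-insertBlock i w =
  trans (firstPos-++ (punchIn i j) 1 (map (punchIn i) (toList w)) [ i ]
          (trans (any-map-injective (punchIn-injective i _ _) j (toList w)) j∈w))
        (firstPos-map-injective (punchIn-injective i _ _) j 1 (toList w))

tabulate-insertAt : ∀ {k} (f : Fin (suc k) → ℕ) (g : Fin k → ℕ) i y →
  f i ≡ y → (∀ j → f (punchIn i j) ≡ g j) → tabulate f ≡ insertAt (toℕ i) y (tabulate g)
tabulate-insertAt         f g zero    y fi≡y f∘punchIn≗g = cong₂ _∷_ fi≡y (List.tabulate-cong f∘punchIn≗g)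
tabulate-insertAt {suc k} f g (suc i) y fi≡y f∘punchIn≗g =
  cong₂ _∷_ (f∘punchIn≗g zero) (tabulate-insertAt (f ∘ suc) (g ∘ suc) i y fi≡y (f∘punchIn≗g ∘ suc))

openers-insertBlock : ∀ {m k} (i : Fin (suc k)) (w : Vec (Fin k) m) → surjective w ≡ true →
  openers (insertBlock i w) ≡ insertAt (toℕ i) (suc m) (openers w)
openers-insertBlock {m} i w surj = begin
  openers (insertBlock i w)
    ≡⟨ openers-tabulate (insertBlock i w) ⟩
  tabulate (opener (insertBlock i w))
    ≡⟨ tabulate-insertAt (opener (insertBlock i w)) (opener w) i (suc m) (opener-insertBlock-new i w)
         (λ j → opener-insertBlock-punchIn i j w (surjective⇒occursIn w surj j)) ⟩
  insertAt (toℕ i) (suc m) (tabulate (opener w))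
    ≡⟨ cong (insertAt (toℕ i) (suc m)) (openers-tabulate w) ⟨
  insertAt (toℕ i) (suc m) (openers w)
    ∎
  where open ≡-Reasoning

isCanonical-insertBlock-suc : ∀ {m k} (i : Fin k) (w : Vec (Fin k) (suc m)) →
  isCanonical (insertBlock (suc i) w) ≡ isCanonical w
isCanonical-insertBlock-suc i w@(zero  ∷ _) = cong (_∧ true) (surjective-insertBlock (suc i) w)
isCanonical-insertBlock-suc i w@(suc _ ∷ _) = cong (_∧ false) (surjective-insertBlock (suc i) w)

isCanonical-insertBlock-zero : ∀ {m k} (w : Vec (Fin k) (suc m)) →
  isCanonical (insertBlock zero w) ≡ false
isCanonical-insertBlock-zero w@(_ ∷ _) = ∧-zeroʳ (surjective (insertBlock zero w))

counted : ∀ {n k} → ℤ → Vec (Fin k) n → Bool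
counted (+ ℓ)    v = isCanonical v ∧ (rightValleys (openers v) ≡ᵇ ℓ)
counted -[1+ _ ] v = false

u≡sumVec : ∀ n k z → u n k z ≡ sumVec {k} n (χ ∘ counted z)
u≡sumVec n k (+ ℓ)    = length-filterᵇ-allVecs n k (counted (+ ℓ))
u≡sumVec n k -[1+ _ ] = sym (sumVec-zero n)

counted⇒surjective : ∀ {n k} z (v : Vec (Fin k) n) → counted z v ≡ true → surjective v ≡ true
counted⇒surjective (+ ℓ) v c = ∧≡true⇒ˡ (∧≡true⇒ˡ c)

counted-∷ʳ-occurring : ∀ {n k} z (v : Vec (Fin k) n) i → occursIn i v ≡ true →
  counted z (v ∷ʳ i) ≡ counted z v
counted-∷ʳ-occurring -[1+ _ ] v i _ = refl
counted-∷ʳ-occurring (+ ℓ) v@(_ ∷ _) i i∈v rewrite surjective-∷ʳ v i i∈v with surjective v in surj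
... | true  rewrite openers-∷ʳ v i surj = refl
... | false = refl

counted-insertBlock-zero : ∀ {m k} z (w : Vec (Fin k) (suc m)) → counted z (insertBlock zero w) ≡ false
counted-insertBlock-zero (+ ℓ)    w =
  cong (_∧ (rightValleys (openers (insertBlock zero w)) ≡ᵇ ℓ)) (isCanonical-insertBlock-zero w)
counted-insertBlock-zero -[1+ _ ] w = refl

counted-insertBlock-suc : ∀ {m k} ℓ (i : Fin k) (w : Vec (Fin k) (suc m)) →
  counted (+ ℓ) (insertBlock (suc i) w)
  ≡ isCanonical w ∧ (rightValleys (insertAt (suc (toℕ i)) (suc (suc m)) (openers w)) ≡ᵇ ℓ)
counted-insertBlock-suc ℓ i w rewrite isCanonical-insertBlock-suc i w with isCanonical w in can
... | true  = cong (λ os → rightValleys os ≡ᵇ ℓ) (openers-insertBlock (suc i) w (∧≡true⇒ˡ can))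
... | false = refl

counted-pred : ∀ {n k} ℓ (v : Vec (Fin k) n) →
  counted (+ ℓ -ℤ + 1) v ≡ isCanonical v ∧ (suc (rightValleys (openers v)) ≡ᵇ ℓ)
counted-pred zero    v = sym (∧-zeroʳ (isCanonical v))
counted-pred (suc ℓ) v = refl

χ-counted-∷ʳ : ∀ {n k} z (v : Vec (Fin k) n) i →
  χ (counted z (v ∷ʳ i)) ≡ χ (counted z v) + χ (not (occursIn i v)) * χ (counted z (v ∷ʳ i))
χ-counted-∷ʳ z v i with occursIn i v in i∈v
... | true  rewrite counted-∷ʳ-occurring z v i i∈v = sym (+-identityʳ _)
... | false with counted z v in c
...   | true with () ← trans (sym (surjective⇒occursIn v (counted⇒surjective z v c) i)) i∈v
...   | false = sym (+-identityʳ _)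

∑-counted-∷ʳ : ∀ {n k} z (v : Vec (Fin k) n) →
  ∑[ i < k ] χ (counted z (v ∷ʳ i))
  ≡ k * χ (counted z v) + ∑[ i < k ] (χ (not (occursIn i v)) * χ (counted z (v ∷ʳ i)))
∑-counted-∷ʳ {k = k} z v = begin
  ∑[ i < k ] χ (counted z (v ∷ʳ i))                    ≡⟨ ∑-cong k (χ-counted-∷ʳ z v) ⟩
  ∑[ i < k ] (χ (counted z v) + fresh i)                ≡⟨ ∑-distrib-+ {k} (λ _ → χ (counted z v)) fresh ⟩
  ∑[ i < k ] χ (counted z v) + ∑[ i < k ] fresh i       ≡⟨ cong (_+ ∑[ i < k ] fresh i) (∑-const k _) ⟩
  k * χ (counted z v) + ∑[ i < k ] fresh i              ∎
  where
  open ≡-Reasoning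
  fresh : Fin k → ℕ
  fresh i = χ (not (occursIn i v)) * χ (counted z (v ∷ʳ i))

∑-punchIn : ∀ k (i : Fin (suc k)) (h : Fin (suc k) → ℕ) →
  ∑[ j < suc k ] (χ (not (finEq i j)) * h j) ≡ ∑[ j < k ] h (punchIn i j)
∑-punchIn k i h = begin
  ∑[ j < suc k ] (χ (not (finEq i j)) * h j)
    ≡⟨ sum-remove {i = i} (λ j → χ (not (finEq i j)) * h j) ⟩
  χ (not (finEq i i)) * h i + ∑[ j < k ] (χ (not (finEq i (punchIn i j))) * h (punchIn i j))
    ≡⟨ cong₂ _+_ (cong (λ b → χ (not b) * h i) (finEq-refl i))
                 (∑-cong k λ j → cong (λ b → χ (not b) * h (punchIn i j))
                                      (dec-false (finEq? i (punchIn i j)) (punchInᵢ≢i i j ∘ sym))) ⟩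
  ∑[ j < k ] (1 * h (punchIn i j))
    ≡⟨ ∑-cong k (λ j → +-identityʳ (h (punchIn i j))) ⟩
  ∑[ j < k ] h (punchIn i j)
    ∎
  where open ≡-Reasoning

sumVec-fresh : ∀ {k} n (i : Fin (suc k)) (f : Vec (Fin (suc k)) n → ℕ) →
  sumVec n (λ v → χ (not (occursIn i v)) * f v) ≡ sumVec n (f ∘ Vec.map (punchIn i))
sumVec-fresh         zero    i f = +-identityʳ (f [])
sumVec-fresh {k} (suc n) i f = begin
  ∑[ j < suc k ] sumVec n (λ v → χ (not (finEq i j ∨ occursIn i v)) * f (j ∷ v))
    ≡⟨ ∑-cong (suc k) (λ j → sumVec-cong n (λ v → χ-not-∨ (finEq i j) (occursIn i v) (f (j ∷ v)))) ⟩
  ∑[ j < suc k ] sumVec n (λ v → other j * (fresh v * f (j ∷ v)))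
    ≡⟨ ∑-cong (suc k) (λ j → *-distribˡ-sumVec n (other j) (λ v → fresh v * f (j ∷ v))) ⟨
  ∑[ j < suc k ] (other j * sumVec n (λ v → fresh v * f (j ∷ v)))
    ≡⟨ ∑-cong (suc k) (λ j → cong (other j *_) (sumVec-fresh n i (f ∘ (j ∷_)))) ⟩
  ∑[ j < suc k ] (other j * sumVec n (λ w → f (j ∷ Vec.map (punchIn i) w)))
    ≡⟨ ∑-punchIn k i (λ j → sumVec n (λ w → f (j ∷ Vec.map (punchIn i) w))) ⟩
  ∑[ j < k ] sumVec n (λ w → f (punchIn i j ∷ Vec.map (punchIn i) w))
    ∎
  where
  open ≡-Reasoning
  other : Fin (suc k) → ℕ
  other j = χ (not (finEq i j))
  fresh : Vec (Fin (suc k)) n → ℕ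
  fresh v = χ (not (occursIn i v))

sumVec-∑-fresh : ∀ {k} n (g : Fin (suc k) → Vec (Fin (suc k)) n → ℕ) →
  sumVec n (λ v → ∑[ i < suc k ] (χ (not (occursIn i v)) * g i v))
  ≡ sumVec n (λ w → ∑[ i < suc k ] g i (Vec.map (punchIn i) w))
sumVec-∑-fresh {k} n g = begin
  sumVec n (λ v → ∑[ i < suc k ] (χ (not (occursIn i v)) * g i v))
    ≡⟨ sumVec-∑-comm n (suc k) (λ i v → χ (not (occursIn i v)) * g i v) ⟩
  ∑[ i < suc k ] sumVec n (λ v → χ (not (occursIn i v)) * g i v)
    ≡⟨ ∑-cong (suc k) (λ i → sumVec-fresh n i (g i)) ⟩
  ∑[ i < suc k ] sumVec n (g i ∘ Vec.map (punchIn i))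
    ≡⟨ sumVec-∑-comm n (suc k) (λ i → g i ∘ Vec.map (punchIn i)) ⟨
  sumVec n (λ w → ∑[ i < suc k ] g i (Vec.map (punchIn i) w))
    ∎
  where open ≡-Reasoning

∑-insertBlock-valleys : ∀ {m k} ℓ (w : Vec (Fin (suc k)) (suc m)) → isCanonical w ≡ true →
  let r = rightValleys (openers w) in
  ∑[ i < suc k ] χ (rightValleys (insertAt (suc (toℕ i)) (suc (suc m)) (openers w)) ≡ᵇ ℓ)
  ≡ (2 * ℓ + 1) * χ (r ≡ᵇ ℓ) + (suc (suc k) ∸ 2 * ℓ) * χ (suc r ≡ᵇ ℓ)
∑-insertBlock-valleys ℓ w@(suc _ ∷ _) can with () ← trans (sym (∧-zeroʳ (surjective w))) can
-- openers w unfolds to opener w zero ∷ map (opener w) (tabulate suc), and opener w zero is 1.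
∑-insertBlock-valleys ℓ w@(zero ∷ _) can with _ ∷ tail≥1 ← openers-≥1 w (∧≡true⇒ˡ can) =
  insertMax-valleys (opener w zero) (map (opener w) (tabulate suc)) ℓ
    (trans (List.length-map (opener w) (tabulate suc)) (List.length-tabulate suc))
    (openers-< w surj) (Linked.AllPairs⇒Linked (openers-distinct w surj)) (all≥⇒>head≡false tail≥1)
  where
  surj : surjective w ≡ true
  surj = ∧≡true⇒ˡ can

∑-counted-insertBlock : ∀ {m k} ℓ (w : Vec (Fin k) (suc m)) →
  ∑[ i < suc k ] χ (counted (+ ℓ) (insertBlock i w))
  ≡ (2 * ℓ + 1) * χ (counted (+ ℓ) w) + (suc k ∸ 2 * ℓ) * χ (counted (+ ℓ -ℤ + 1) w)
∑-counted-insertBlock {k = zero} ℓ (() ∷ _)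
∑-counted-insertBlock {m} {suc k} ℓ w = begin
  ∑[ i < suc (suc k) ] χ (counted (+ ℓ) (insertBlock i w))
    ≡⟨ cong (_+ ∑[ i < suc k ] χ (counted (+ ℓ) (insertBlock (suc i) w)))
            (cong χ (counted-insertBlock-zero (+ ℓ) w)) ⟩
  ∑[ i < suc k ] χ (counted (+ ℓ) (insertBlock (suc i) w))
    ≡⟨ ∑-cong (suc k) (λ i → trans (cong χ (counted-insertBlock-suc ℓ i w)) (χ-∧ (isCanonical w) _)) ⟩
  ∑[ i < suc k ] (c * valleysAfter i)
    ≡⟨ *-distribˡ-sum {suc k} c valleysAfter ⟨
  c * ∑[ i < suc k ] valleysAfter i
    ≡⟨ canonical-case (isCanonical w) refl ⟩
  c * ((2 * ℓ + 1) * χ (r ≡ᵇ ℓ) + (suc (suc k) ∸ 2 * ℓ) * χ (suc r ≡ᵇ ℓ))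
    ≡⟨ distribute c (2 * ℓ + 1) (χ (r ≡ᵇ ℓ)) (suc (suc k) ∸ 2 * ℓ) (χ (suc r ≡ᵇ ℓ)) ⟩
  (2 * ℓ + 1) * (c * χ (r ≡ᵇ ℓ)) + (suc (suc k) ∸ 2 * ℓ) * (c * χ (suc r ≡ᵇ ℓ))
    ≡⟨ cong₂ (λ a b → (2 * ℓ + 1) * a + (suc (suc k) ∸ 2 * ℓ) * b)
             (χ-∧ (isCanonical w) _) (trans (cong χ (counted-pred ℓ w)) (χ-∧ (isCanonical w) _)) ⟨
  (2 * ℓ + 1) * χ (counted (+ ℓ) w) + (suc (suc k) ∸ 2 * ℓ) * χ (counted (+ ℓ -ℤ + 1) w)
    ∎
  where
  open ≡-Reasoning
  c = χ (isCanonical w)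
  r = rightValleys (openers w)
  valleysAfter : Fin (suc k) → ℕ
  valleysAfter i = χ (rightValleys (insertAt (suc (toℕ i)) (suc (suc m)) (openers w)) ≡ᵇ ℓ)
  canonical-case : ∀ b → isCanonical w ≡ b → χ b * ∑[ i < suc k ] valleysAfter i
    ≡ χ b * ((2 * ℓ + 1) * χ (r ≡ᵇ ℓ) + (suc (suc k) ∸ 2 * ℓ) * χ (suc r ≡ᵇ ℓ))
  canonical-case true  can = cong (1 *_) (∑-insertBlock-valleys ℓ w can)
  canonical-case false _   = refl
  distribute : ∀ c a x b y → c * (a * x + b * y) ≡ a * (c * x) + b * (c * y)
  distribute = solve-∀

u-split-last : ∀ n k z →
  u (suc n) (suc k) z
  ≡ suc k * u n (suc k) z + sumVec {k} n (λ w → ∑[ i < suc k ] χ (counted z (insertBlock i w)))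
u-split-last n k z = begin
  u (suc n) (suc k) z
    ≡⟨ u≡sumVec (suc n) (suc k) z ⟩
  sumVec (suc n) C
    ≡⟨ sumVec-∷ʳ n C ⟩
  sumVec n (λ v → ∑[ i < suc k ] C (v ∷ʳ i))
    ≡⟨ sumVec-cong n (∑-counted-∷ʳ z) ⟩
  sumVec n (λ v → suc k * C v + fresh v)
    ≡⟨ sumVec-distrib-+ n (λ v → suc k * C v) fresh ⟩
  sumVec n (λ v → suc k * C v) + sumVec n fresh
    ≡⟨ cong₂ _+_ (sym (*-distribˡ-sumVec n (suc k) C)) (sumVec-∑-fresh n (λ i v → C (v ∷ʳ i))) ⟩
  suc k * sumVec n C + new
    ≡⟨ cong (λ t → suc k * t + new) (u≡sumVec n (suc k) z) ⟨
  suc k * u n (suc k) z + new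
    ∎
  where
  open ≡-Reasoning
  new = sumVec {k} n (λ w → ∑[ i < suc k ] χ (counted z (insertBlock i w)))
  C : ∀ {n} → Vec (Fin (suc k)) n → ℕ
  C = χ ∘ counted z
  fresh : Vec (Fin (suc k)) n → ℕ
  fresh v = ∑[ i < suc k ] (χ (not (occursIn i v)) * C (v ∷ʳ i))

sumVec-∑-counted-insertBlock : ∀ m k ℓ →
  sumVec {k} (suc m) (λ w → ∑[ i < suc k ] χ (counted (+ ℓ) (insertBlock i w)))
  ≡ (2 * ℓ + 1) * u (suc m) k (+ ℓ) + (suc k ∸ 2 * ℓ) * u (suc m) k (+ ℓ -ℤ + 1)
sumVec-∑-counted-insertBlock m k ℓ = begin
  sumVec (suc m) (λ w → ∑[ i < suc k ] χ (counted (+ ℓ) (insertBlock i w)))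
    ≡⟨ sumVec-cong (suc m) (∑-counted-insertBlock {m} {k} ℓ) ⟩
  sumVec (suc m) (λ w → a * C w + b * C′ w)
    ≡⟨ sumVec-distrib-+ (suc m) (λ w → a * C w) (λ w → b * C′ w) ⟩
  sumVec (suc m) (λ w → a * C w) + sumVec (suc m) (λ w → b * C′ w)
    ≡⟨ cong₂ _+_ (*-distribˡ-sumVec (suc m) a C) (*-distribˡ-sumVec (suc m) b C′) ⟨
  a * sumVec (suc m) C + b * sumVec (suc m) C′
    ≡⟨ cong₂ (λ s t → a * s + b * t) (u≡sumVec (suc m) k (+ ℓ)) (u≡sumVec (suc m) k (+ ℓ -ℤ + 1)) ⟨
  a * u (suc m) k (+ ℓ) + b * u (suc m) k (+ ℓ -ℤ + 1)
    ∎
  where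
  open ≡-Reasoning
  a = 2 * ℓ + 1
  b = suc k ∸ 2 * ℓ
  C C′ : Vec (Fin k) (suc m) → ℕ
  C  = χ ∘ counted (+ ℓ)
  C′ = χ ∘ counted (+ ℓ -ℤ + 1)

proposition4 : (n k ℓ : ℕ) → 2 ≤ n → 2 * ℓ + 1 ≤ k → k ≤ n →
    u n k (+ ℓ) ≡ k * u (n ∸ 1) k (+ ℓ) + (2 * ℓ + 1) * u (n ∸ 1) (k ∸ 1) (+ ℓ)
      + (k ∸ 2 * ℓ) * u (n ∸ 1) (k ∸ 1) (+ ℓ -ℤ + 1)
proposition4 zero          _       _ ()       _      _
proposition4 (suc zero)    _       _ (s≤s ()) _      _
proposition4 (suc (suc m)) zero    ℓ _        2ℓ+1≤0 _ with () ← m+n≤o⇒n≤o (2 * ℓ) 2ℓ+1≤0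
proposition4 (suc (suc m)) (suc k) ℓ _        _      _ = begin
  u (suc (suc m)) (suc k) (+ ℓ)
    ≡⟨ u-split-last (suc m) k (+ ℓ) ⟩
  old + sumVec (suc m) (λ w → ∑[ i < suc k ] χ (counted (+ ℓ) (insertBlock i w)))
    ≡⟨ cong (_+_ old) (sumVec-∑-counted-insertBlock m k ℓ) ⟩
  old + ((2 * ℓ + 1) * u (suc m) k (+ ℓ) + (suc k ∸ 2 * ℓ) * u (suc m) k (+ ℓ -ℤ + 1))
    ≡⟨ +-assoc old _ _ ⟨
  old + (2 * ℓ + 1) * u (suc m) k (+ ℓ) + (suc k ∸ 2 * ℓ) * u (suc m) k (+ ℓ -ℤ + 1)
    ∎
  where
  open ≡-Reasoning
  old = suc k * u (suc m) (suc k) (+ ℓ)
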